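{- Let $\mathcal{S}$ be an additively idempotent semiring. If a first-order sentence $\psi$ is preserved under extensions in $\mathcal{S}$ and there are $\phi\in\Sigma_1$ and $n\in\omega$ with $\phi\equiv^{\ge n}_{\mathcal{S}}\psi$, then there is some $\phi^*\in\Sigma_1$ with $\phi^*\equiv^{\omega}_{\mathcal{S}}\psi$.
   Context: Semirings are commutative $(S,+,\cdot,0,1)$, naturally ordered ($s\le t$ iff $s+r=t$ for some $r$); additively idempotent means $s+s=s$, so $+$ is the binary supremum. An $\mathcal{S}$-interpretation over a nonempty set $A$ maps literals $R\bar a,\neg R\bar a$ ($\bar a$ from $A$) to $S$, model-defining if for each atom exactly one of the two values is $0$; only model-defining ones are considered. First-order formulas with equality in negation normal form are evaluated by: literals via $\pi$; (in)equalities by Boolean value; $\vee$ by $+$, $\wedge$ by $\cdot$, $\exists$ by sum over $A$, $\forall$ by product over $A$. $\pi_A\subseteq\pi_B$ means $A\subseteq B$ and $\pi_A(L)=\pi_B(L)$ for literals over $A$; $\psi$ is preserved under extensions in $\mathcal{S}$ if $\pi_A\subseteq\pi_B$ implies $\pi_A[\![\psi]\!]\le\pi_B[\![\psi]\!]$. $\phi\equiv^{\ge n}_{\mathcal{S}}\psi$ means $\pi[\![\phi]\!]=\pi[\![\psi]\!]$ for all finite $\mathcal{S}$-interpretations whose universe has at least $n$ elements; $\phi\equiv^{\omega}_{\mathcal{S}}\psi$ means this holds for all finite $\mathcal{S}$-interpretations. $\Sigma_1$: sentences $\exists\bar x\,\phi(\bar x)$ with $\phi$ quantifier-free. -}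

module Defs where

open import Level using (Level; _⊔_)
open import Algebra.Bundles using (CommutativeSemiring)
open import Data.Nat using (ℕ; zero; suc; _≤_)
open import Data.Fin using (Fin; zero; suc; _≟_)
open import Data.Vec using (Vec; map)
open import Data.Product using (Σ; ∃; _×_; _,_)
open import Data.Sum using (_⊎_)
open import Relation.Nullary using (¬_; yes; no)
open import Relation.Binary.PropositionalEquality using (_≡_)
open import Function.Definitions using (Injective)

record Signature : Set₁ where
  field
    Rel   : Set
    arity : Rel → ℕ
open Signature public

-- First-order formulas with equality in negation normal form,
-- with n free variables (de Bruijn indices Fin n).
data Formula (τ : Signature) : ℕ → Set where
  pos  : ∀ {n} (R : Rel τ) → Vec (Fin n) (arity τ R) → Formula τ n
  neg  : ∀ {n} (R : Rel τ) → Vec (Fin n) (arity τ R) → Formula τ n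
  eq   : ∀ {n} → Fin n → Fin n → Formula τ n
  neq  : ∀ {n} → Fin n → Fin n → Formula τ n
  _∨ᶠ_ : ∀ {n} → Formula τ n → Formula τ n → Formula τ n
  _∧ᶠ_ : ∀ {n} → Formula τ n → Formula τ n → Formula τ n
  ex   : ∀ {n} → Formula τ (suc n) → Formula τ n
  all  : ∀ {n} → Formula τ (suc n) → Formula τ n

Sentence : Signature → Set
Sentence τ = Formula τ 0

data QF {τ : Signature} : ∀ {n} → Formula τ n → Set where
  pos  : ∀ {n} R (xs : Vec (Fin n) (arity τ R)) → QF (pos R xs)
  neg  : ∀ {n} R (xs : Vec (Fin n) (arity τ R)) → QF (neg R xs)
  eq   : ∀ {n} (x y : Fin n) → QF (eq x y)
  neq  : ∀ {n} (x y : Fin n) → QF (neq x y)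
  _∨ᶠ_ : ∀ {n} {φ ψ : Formula τ n} → QF φ → QF ψ → QF (φ ∨ᶠ ψ)
  _∧ᶠ_ : ∀ {n} {φ ψ : Formula τ n} → QF φ → QF ψ → QF (φ ∧ᶠ ψ)

data IsΣ₁ {τ : Signature} : ∀ {n} → Formula τ n → Set where
  qf : ∀ {n} {φ : Formula τ n} → QF φ → IsΣ₁ φ
  ex : ∀ {n} {φ : Formula τ (suc n)} → IsΣ₁ φ → IsΣ₁ (ex φ)

extend : ∀ {m n} → Fin m → (Fin n → Fin m) → Fin (suc n) → Fin m
extend a ρ zero    = a
extend a ρ (suc i) = ρ i

module Semantics {c ℓ : Level} (S : CommutativeSemiring c ℓ) (τ : Signature) where
  open CommutativeSemiring S using (Carrier; _≈_; _+_; _*_; 0#; 1#)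

  AdditivelyIdempotent : Set (c ⊔ ℓ)
  AdditivelyIdempotent = ∀ s → s + s ≈ s

  _≼_ : Carrier → Carrier → Set (c ⊔ ℓ)
  s ≼ t = ∃ λ r → s + r ≈ t

  sumF : ∀ {m} → (Fin m → Carrier) → Carrier
  sumF {zero}  f = 0#
  sumF {suc m} f = f zero + sumF (λ i → f (suc i))

  prodF : ∀ {m} → (Fin m → Carrier) → Carrier
  prodF {zero}  f = 1#
  prodF {suc m} f = f zero * prodF (λ i → f (suc i))

  record Interp (m : ℕ) : Set c where
    field
      πpos : (R : Rel τ) → Vec (Fin m) (arity τ R) → Carrier
      πneg : (R : Rel τ) → Vec (Fin m) (arity τ R) → Carrier
  open Interp public

  ModelDefining : ∀ {m} → Interp m → Set ℓ
  ModelDefining π = ∀ R as →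
      (πpos π R as ≈ 0# × ¬ (πneg π R as ≈ 0#))
    ⊎ (¬ (πpos π R as ≈ 0#) × πneg π R as ≈ 0#)

  boolVal : ∀ {m} → Fin m → Fin m → Carrier
  boolVal a b with a ≟ b
  ... | yes _ = 1#
  ... | no  _ = 0#

  notBoolVal : ∀ {m} → Fin m → Fin m → Carrier
  notBoolVal a b with a ≟ b
  ... | yes _ = 0#
  ... | no  _ = 1#

  ⟦_⟧ : ∀ {m n} → Formula τ n → Interp m → (Fin n → Fin m) → Carrier
  ⟦ pos R xs ⟧ π ρ = πpos π R (map ρ xs)
  ⟦ neg R xs ⟧ π ρ = πneg π R (map ρ xs)
  ⟦ eq x y ⟧ π ρ = boolVal (ρ x) (ρ y)
  ⟦ neq x y ⟧ π ρ = notBoolVal (ρ x) (ρ y)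
  ⟦ φ ∨ᶠ ψ ⟧ π ρ = ⟦ φ ⟧ π ρ + ⟦ ψ ⟧ π ρ
  ⟦ φ ∧ᶠ ψ ⟧ π ρ = ⟦ φ ⟧ π ρ * ⟦ ψ ⟧ π ρ
  ⟦ ex φ ⟧ π ρ = sumF (λ a → ⟦ φ ⟧ π (extend a ρ))
  ⟦ all φ ⟧ π ρ = prodF (λ a → ⟦ φ ⟧ π (extend a ρ))

  ⟦_⟧ˢ : ∀ {m} → Sentence τ → Interp m → Carrier
  ⟦ φ ⟧ˢ π = ⟦ φ ⟧ π (λ ())

  -- π_A ⊆ π_B, up to renaming universes: an injective embedding of the
  -- universe Fin m into Fin m' along which all literal values agree.
  _⊆[_]_ : ∀ {m m'} → Interp m → (Fin m → Fin m') → Interp m' → Set ℓ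
  π ⊆[ f ] π' = Injective _≡_ _≡_ f
              × (∀ R as → πpos π R as ≈ πpos π' R (map f as))
              × (∀ R as → πneg π R as ≈ πneg π' R (map f as))

  -- universes are nonempty finite sets: Fin (suc k)
  PreservedUnderExtensions : Sentence τ → Set (c ⊔ ℓ)
  PreservedUnderExtensions ψ =
    ∀ {k k'} (π : Interp (suc k)) (π' : Interp (suc k')) (f : Fin (suc k) → Fin (suc k')) →
    ModelDefining π → ModelDefining π' → π ⊆[ f ] π' → ⟦ ψ ⟧ˢ π ≼ ⟦ ψ ⟧ˢ π'

  EquivGe : ℕ → Sentence τ → Sentence τ → Set (c ⊔ ℓ)
  EquivGe n φ ψ = ∀ {k} (π : Interp (suc k)) → ModelDefining π → n ≤ suc k → ⟦ φ ⟧ˢ π ≈ ⟦ ψ ⟧ˢ π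

  EquivFin : Sentence τ → Sentence τ → Set (c ⊔ ℓ)
  EquivFin φ ψ = ∀ {k} (π : Interp (suc k)) → ModelDefining π → ⟦ φ ⟧ˢ π ≈ ⟦ ψ ⟧ˢ π

-- Over an additively idempotent semiring, + is a join, an existential is the
-- supremum of its instances, and preservation under extensions says that the
-- value of ψ dominates its value on every substructure.  Let φ = ∃ȳ α(ȳ) agree
-- with ψ on universes of size ≥ N and put
--
--   φ* = ∃ȳ ∃x₁…x_N ( (x̄ pairwise distinct ∧ α(ȳ))
--                    ∨ ⋁_{0<s<N} (x₁…x_s pairwise distinct ∧ ψ relativised to {x₁…x_s}) ).
--
-- Every disjunct is below ψ: the first one only contributes on universes of size
-- ≥ N, where it is bounded by φ = ψ, and the others are values of ψ on
-- substructures.  Conversely, on a universe of size ≥ N each α(ȳ) appears as a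
-- first disjunct, and on a smaller universe the whole universe appears as one of
-- the substructures {x₁…x_s}.  Hence φ* = ψ on all finite universes.
module Submission where

open import Defs
open import Algebra.Bundles using (CommutativeSemiring)
open import Data.Nat using (ℕ; zero; suc; _≤_; _<_; s≤s; _≤?_)
open import Data.Product using (Σ; _×_; _,_)
open import Algebra.Lattice.Bundles using (Semilattice)
import Algebra.Lattice.Properties.Semilattice as SemilatticeProperties
open import Data.Empty using (⊥-elim)
open import Data.Fin using (Fin; zero; suc; toℕ; fromℕ<; inject≤; cast; _≟_)
open import Data.Fin.Properties
  using (toℕ<n; toℕ-fromℕ<; cast-involutive; injective⇒≤; inject≤-injective)
open import Data.Nat.Properties using (≤-pred; ≰⇒>; m≤n⇒m≤1+n; ≤-trans; n≤1+n)
open import Data.Vec using (Vec; map)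
open import Data.Vec.Properties using (map-∘; map-cong; map-id)
open import Function using (_∘_; id)
open import Function.Definitions using (Injective)
open import Relation.Binary.Lattice using (JoinSemilattice)
import Relation.Binary.Reasoning.PartialOrder as PosetReasoning
open import Relation.Nullary using (yes; no)
open import Relation.Binary.PropositionalEquality as ≡
  using (_≡_; refl; cong; cong₂)

-- Contexts of variables

-- k ⊕ n is the context n under k more binders; recursion on k moving suc to the
-- right makes k ⊕ suc n and suc k ⊕ n agree definitionally.
_⊕_ : ℕ → ℕ → ℕ
zero  ⊕ n = n
suc k ⊕ n = k ⊕ suc n

weaken : ∀ {n} k → Fin n → Fin (k ⊕ n)
weaken zero    i = i
weaken (suc k) i = weaken k (suc i)

fresh : ∀ {n} k → Fin k → Fin (k ⊕ n)
fresh (suc k) zero    = weaken k zero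
fresh (suc k) (suc i) = fresh k i

extendMany : ∀ {n m} k → (Fin k → Fin m) → (Fin n → Fin m) → Fin (k ⊕ n) → Fin m
extendMany zero    u v = v
extendMany (suc k) u v = extendMany k (u ∘ suc) (extend (u zero) v)

extendMany-weaken : ∀ {n m} k (u : Fin k → Fin m) (v : Fin n → Fin m) i →
                    extendMany k u v (weaken k i) ≡ v i
extendMany-weaken zero    u v i = refl
extendMany-weaken (suc k) u v i = extendMany-weaken k (u ∘ suc) (extend (u zero) v) (suc i)

extendMany-fresh : ∀ {n m} k (u : Fin k → Fin m) (v : Fin n → Fin m) i →
                   extendMany k u v (fresh k i) ≡ u i
extendMany-fresh (suc k) u v zero    = extendMany-weaken k (u ∘ suc) (extend (u zero) v) zero
extendMany-fresh (suc k) u v (suc i) = extendMany-fresh k (u ∘ suc) (extend (u zero) v) i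

clamp : ∀ {k m} → Fin m → Fin (suc k)
clamp {zero}  _       = zero
clamp {suc k} zero    = zero
clamp {suc k} (suc i) = suc (clamp i)

clamp-inject≤ : ∀ {k m} (i : Fin (suc k)) (k<m : suc k ≤ m) → clamp (inject≤ i k<m) ≡ i
clamp-inject≤ {zero}  zero    _         = refl
clamp-inject≤ {suc k} zero    (s≤s _)   = refl
clamp-inject≤ {suc k} (suc i) (s≤s k≤m) = cong suc (clamp-inject≤ i k≤m)

-- Syntax

module _ {τ : Signature} where

  ∃* : ∀ {n} k → Formula τ (k ⊕ n) → Formula τ n
  ∃* zero    φ = φ
  ∃* (suc k) φ = ex (∃* k φ)

  ∃*-Σ₁ : ∀ {n} k {φ : Formula τ (k ⊕ n)} → IsΣ₁ φ → IsΣ₁ (∃* k φ)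
  ∃*-Σ₁ zero    h = h
  ∃*-Σ₁ (suc k) h = ex (∃*-Σ₁ k h)

  prefixLength : ∀ {n} {φ : Formula τ n} → IsΣ₁ φ → ℕ
  prefixLength (qf _) = zero
  prefixLength (ex h) = suc (prefixLength h)

  matrix : ∀ {n} {φ : Formula τ n} (h : IsΣ₁ φ) → Formula τ (prefixLength h ⊕ n)
  matrix {φ = φ} (qf _) = φ
  matrix (ex h) = matrix h

  matrix-QF : ∀ {n} {φ : Formula τ n} (h : IsΣ₁ φ) → QF (matrix h)
  matrix-QF (qf q) = q
  matrix-QF (ex h) = matrix-QF h

  ∃*-matrix : ∀ {n} {φ : Formula τ n} (h : IsΣ₁ φ) → φ ≡ ∃* (prefixLength h) (matrix h)
  ∃*-matrix (qf _) = refl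
  ∃*-matrix (ex h) = cong ex (∃*-matrix h)

  -- The language has no truth constants; a variable z of the context supplies
  -- z ≠ z and z = z as the empty disjunction and conjunction.
  ⋁ : ∀ {K} → Fin K → ∀ {n} → (Fin n → Formula τ K) → Formula τ K
  ⋁ z {zero}  f = neq z z
  ⋁ z {suc n} f = f zero ∨ᶠ ⋁ z (f ∘ suc)

  ⋀ : ∀ {K} → Fin K → ∀ {n} → (Fin n → Formula τ K) → Formula τ K
  ⋀ z {zero}  f = eq z z
  ⋀ z {suc n} f = f zero ∧ᶠ ⋀ z (f ∘ suc)

  ⋁-QF : ∀ {K} (z : Fin K) {n} {f : Fin n → Formula τ K} → (∀ i → QF (f i)) → QF (⋁ z f)
  ⋁-QF z {zero}  q = neq z z
  ⋁-QF z {suc n} q = q zero ∨ᶠ ⋁-QF z (q ∘ suc)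

  ⋀-QF : ∀ {K} (z : Fin K) {n} {f : Fin n → Formula τ K} → (∀ i → QF (f i)) → QF (⋀ z f)
  ⋀-QF z {zero}  q = eq z z
  ⋀-QF z {suc n} q = q zero ∧ᶠ ⋀-QF z (q ∘ suc)

  -- φ with its free variables placed by v ∘ σ and its quantifiers ranging over
  -- the k variables v; on quantifier-free φ this is renaming along v ∘ σ.
  relativize : ∀ {a k K} → Fin K → (Fin k → Fin K) → Formula τ a → (Fin a → Fin k) → Formula τ K
  relativize z v (pos R xs) σ = pos R (map (v ∘ σ) xs)
  relativize z v (neg R xs) σ = neg R (map (v ∘ σ) xs)
  relativize z v (eq x y)   σ = eq (v (σ x)) (v (σ y))
  relativize z v (neq x y)  σ = neq (v (σ x)) (v (σ y))
  relativize z v (φ ∨ᶠ ψ)   σ = relativize z v φ σ ∨ᶠ relativize z v ψ σ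
  relativize z v (φ ∧ᶠ ψ)   σ = relativize z v φ σ ∧ᶠ relativize z v ψ σ
  relativize z v (ex φ)     σ = ⋁ z (λ i → relativize z v φ (extend i σ))
  relativize z v (all φ)    σ = ⋀ z (λ i → relativize z v φ (extend i σ))

  relativize-QF : ∀ {a k K} (z : Fin K) (v : Fin k → Fin K) (φ : Formula τ a) σ →
                  QF (relativize z v φ σ)
  relativize-QF z v (pos R xs) σ = pos R _
  relativize-QF z v (neg R xs) σ = neg R _
  relativize-QF z v (eq x y)   σ = eq _ _
  relativize-QF z v (neq x y)  σ = neq _ _
  relativize-QF z v (φ ∨ᶠ ψ)   σ = relativize-QF z v φ σ ∨ᶠ relativize-QF z v ψ σ
  relativize-QF z v (φ ∧ᶠ ψ)   σ = relativize-QF z v φ σ ∧ᶠ relativize-QF z v ψ σ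
  relativize-QF z v (ex φ)     σ = ⋁-QF z (λ i → relativize-QF z v φ (extend i σ))
  relativize-QF z v (all φ)    σ = ⋀-QF z (λ i → relativize-QF z v φ (extend i σ))

  apart : ∀ {k K} → (Fin k → Fin K) → Fin k → Fin k → Formula τ K
  apart v i j with i ≟ j
  ... | yes _ = eq (v i) (v i)
  ... | no  _ = neq (v i) (v j)

  apart-QF : ∀ {k K} (v : Fin k → Fin K) i j → QF (apart v i j)
  apart-QF v i j with i ≟ j
  ... | yes _ = eq _ _
  ... | no  _ = neq _ _

  distinct : ∀ {k K} → Fin K → (Fin k → Fin K) → Formula τ K
  distinct z v = ⋀ z (λ i → ⋀ z (apart v i))

  distinct-QF : ∀ {k K} (z : Fin K) (v : Fin k → Fin K) → QF (distinct z v)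
  distinct-QF z v = ⋀-QF z (λ i → ⋀-QF z (apart-QF v i))

  relativizeˢ : ∀ {k K} → Fin K → (Fin k → Fin K) → Sentence τ → Formula τ K
  relativizeˢ z v ψ = relativize z v ψ (λ ())

  -- ψ in the substructure spanned by the values of v if these are distinct, 0# otherwise.
  inSubstructure : ∀ {k K} → Fin K → (Fin k → Fin K) → Sentence τ → Formula τ K
  inSubstructure z v ψ = distinct z v ∧ᶠ relativizeˢ z v ψ

  inSubstructure-QF : ∀ {k K} (z : Fin K) (v : Fin k → Fin K) ψ → QF (inSubstructure z v ψ)
  inSubstructure-QF z v ψ = distinct-QF z v ∧ᶠ relativize-QF z v ψ (λ ())

-- φ* of the header with N = suc n: the fresh variable x₀ then exists to serve as the
-- variable z of ⋁ and ⋀.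
module Σ₁Completion {τ : Signature} (ψ : Sentence τ) {φ : Sentence τ} (φ-Σ₁ : IsΣ₁ φ) (n : ℕ) where

  N : ℕ
  N = suc n

  Ctx : ℕ
  Ctx = N ⊕ (prefixLength φ-Σ₁ ⊕ 0)

  x₀ : Fin Ctx
  x₀ = fresh N zero

  suc-toℕ≤N : (j : Fin n) → suc (toℕ j) ≤ N
  suc-toℕ≤N j = m≤n⇒m≤1+n (toℕ<n j)

  firstVars : (j : Fin n) → Fin (suc (toℕ j)) → Fin Ctx
  firstVars j i = fresh N (inject≤ i (suc-toℕ≤N j))

  large : Formula τ Ctx
  large = distinct x₀ (fresh N) ∧ᶠ relativize x₀ (weaken N) (matrix φ-Σ₁) id

  small : Fin n → Formula τ Ctx
  small j = inSubstructure x₀ (firstVars j) ψ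

  body : Formula τ Ctx
  body = large ∨ᶠ ⋁ x₀ small

  body-QF : QF body
  body-QF = (distinct-QF x₀ (fresh N) ∧ᶠ relativize-QF x₀ (weaken N) (matrix φ-Σ₁) id)
         ∨ᶠ ⋁-QF x₀ (λ j → inSubstructure-QF x₀ (firstVars j) ψ)

  completion : Sentence τ
  completion = ∃* (prefixLength φ-Σ₁) (∃* N body)

  completion-Σ₁ : IsΣ₁ completion
  completion-Σ₁ = ∃*-Σ₁ (prefixLength φ-Σ₁) (∃*-Σ₁ N (qf body-QF))

-- Semantics

module Evaluation {c ℓ} (S : CommutativeSemiring c ℓ) (τ : Signature) where
  open CommutativeSemiring S
    hiding (zero) renaming (refl to ≈-refl; sym to ≈-sym; trans to ≈-trans)
  open Semantics S τ

  sumF-cong : ∀ {k} {f g : Fin k → Carrier} → (∀ i → f i ≡ g i) → sumF f ≡ sumF g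
  sumF-cong {zero}  e = refl
  sumF-cong {suc k} e = cong₂ _+_ (e zero) (sumF-cong (e ∘ suc))

  prodF-cong : ∀ {k} {f g : Fin k → Carrier} → (∀ i → f i ≡ g i) → prodF f ≡ prodF g
  prodF-cong {zero}  e = refl
  prodF-cong {suc k} e = cong₂ _*_ (e zero) (prodF-cong (e ∘ suc))

  prodF-1# : ∀ {k} (f : Fin k → Carrier) → (∀ i → f i ≈ 1#) → prodF f ≈ 1#
  prodF-1# {zero}  f h = ≈-refl
  prodF-1# {suc k} f h = ≈-trans (*-cong (h zero) (prodF-1# (f ∘ suc) (h ∘ suc))) (*-identityˡ 1#)

  boolVal-refl : ∀ {m} (a : Fin m) → boolVal a a ≡ 1#
  boolVal-refl a with a ≟ a
  ... | yes _  = refl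
  ... | no a≢a = ⊥-elim (a≢a refl)

  notBoolVal-refl : ∀ {m} (a : Fin m) → notBoolVal a a ≡ 0#
  notBoolVal-refl a with a ≟ a
  ... | yes _  = refl
  ... | no a≢a = ⊥-elim (a≢a refl)

  boolVal-injective : ∀ {K m} {g : Fin K → Fin m} → Injective _≡_ _≡_ g →
                      ∀ a b → boolVal (g a) (g b) ≡ boolVal a b
  boolVal-injective {g = g} inj a b with a ≟ b | g a ≟ g b
  ... | yes _   | yes _   = refl
  ... | yes a≡b | no ne   = ⊥-elim (ne (cong g a≡b))
  ... | no ne   | yes e   = ⊥-elim (ne (inj e))
  ... | no _    | no _    = refl

  notBoolVal-injective : ∀ {K m} {g : Fin K → Fin m} → Injective _≡_ _≡_ g →
                         ∀ a b → notBoolVal (g a) (g b) ≡ notBoolVal a b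
  notBoolVal-injective {g = g} inj a b with a ≟ b | g a ≟ g b
  ... | yes _   | yes _   = refl
  ... | yes a≡b | no ne   = ⊥-elim (ne (cong g a≡b))
  ... | no ne   | yes e   = ⊥-elim (ne (inj e))
  ... | no _    | no _    = refl

  extend-cong : ∀ {n m} (a : Fin m) {ρ ρ' : Fin n → Fin m} → (∀ i → ρ i ≡ ρ' i) →
                ∀ i → extend a ρ i ≡ extend a ρ' i
  extend-cong a e zero    = refl
  extend-cong a e (suc i) = e i

  ⟦⟧-cong : ∀ {m n} (φ : Formula τ n) (π : Interp m) {ρ ρ' : Fin n → Fin m} →
            (∀ i → ρ i ≡ ρ' i) → ⟦ φ ⟧ π ρ ≡ ⟦ φ ⟧ π ρ'
  ⟦⟧-cong (pos R xs) π e = cong (πpos π R) (map-cong e xs)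
  ⟦⟧-cong (neg R xs) π e = cong (πneg π R) (map-cong e xs)
  ⟦⟧-cong (eq x y)   π e = cong₂ boolVal (e x) (e y)
  ⟦⟧-cong (neq x y)  π e = cong₂ notBoolVal (e x) (e y)
  ⟦⟧-cong (φ ∨ᶠ ψ)   π e = cong₂ _+_ (⟦⟧-cong φ π e) (⟦⟧-cong ψ π e)
  ⟦⟧-cong (φ ∧ᶠ ψ)   π e = cong₂ _*_ (⟦⟧-cong φ π e) (⟦⟧-cong ψ π e)
  ⟦⟧-cong (ex φ)     π e = sumF-cong (λ a → ⟦⟧-cong φ π (extend-cong a e))
  ⟦⟧-cong (all φ)    π e = prodF-cong (λ a → ⟦⟧-cong φ π (extend-cong a e))

  ⟦⋁⟧ : ∀ {K m} (z : Fin K) {n} (f : Fin n → Formula τ K) (π : Interp m) ρ →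
        ⟦ ⋁ z f ⟧ π ρ ≡ sumF (λ i → ⟦ f i ⟧ π ρ)
  ⟦⋁⟧ z {zero}  f π ρ = notBoolVal-refl (ρ z)
  ⟦⋁⟧ z {suc n} f π ρ = cong (⟦ f zero ⟧ π ρ +_) (⟦⋁⟧ z (f ∘ suc) π ρ)

  ⟦⋀⟧ : ∀ {K m} (z : Fin K) {n} (f : Fin n → Formula τ K) (π : Interp m) ρ →
        ⟦ ⋀ z f ⟧ π ρ ≡ prodF (λ i → ⟦ f i ⟧ π ρ)
  ⟦⋀⟧ z {zero}  f π ρ = boolVal-refl (ρ z)
  ⟦⋀⟧ z {suc n} f π ρ = cong (⟦ f zero ⟧ π ρ *_) (⟦⋀⟧ z (f ∘ suc) π ρ)

  restrict : ∀ {K m} → Interp m → (Fin K → Fin m) → Interp K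
  restrict π g = record { πpos = λ R as → πpos π R (map g as)
                        ; πneg = λ R as → πneg π R (map g as) }

  restrict-ModelDefining : ∀ {K m} (π : Interp m) (g : Fin K → Fin m) →
                           ModelDefining π → ModelDefining (restrict π g)
  restrict-ModelDefining π g md R as = md R (map g as)

  restrict-⊆ : ∀ {K m} (π : Interp m) {g : Fin K → Fin m} →
               Injective _≡_ _≡_ g → restrict π g ⊆[ g ] π
  restrict-⊆ π inj = inj , (λ R as → ≈-refl) , (λ R as → ≈-refl)

  ⊆-restrict : ∀ {K m} (π : Interp m) {g : Fin K → Fin m} {h : Fin m → Fin K} →
               (∀ x → g (h x) ≡ x) → π ⊆[ h ] restrict π g
  ⊆-restrict π {g} {h} gh≡id = h-injective , (λ R as → reflexive (cong (πpos π R) (gh-map as)))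
                                           , (λ R as → reflexive (cong (πneg π R) (gh-map as)))
    where
      h-injective : Injective _≡_ _≡_ h
      h-injective {x} {y} hx≡hy = ≡.trans (≡.sym (gh≡id x)) (≡.trans (cong g hx≡hy) (gh≡id y))

      gh-map : ∀ {a} (as : Vec _ a) → as ≡ map g (map h as)
      gh-map as = ≡.sym (≡.trans (≡.sym (map-∘ g h as)) (≡.trans (map-cong gh≡id as) (map-id as)))

  ⟦relativize⟧ : ∀ {a k K m} (z : Fin K) (v : Fin k → Fin K) (φ : Formula τ a) σ
                 (π : Interp m) (ρ : Fin K → Fin m) → Injective _≡_ _≡_ (ρ ∘ v) →
                 ⟦ relativize z v φ σ ⟧ π ρ ≡ ⟦ φ ⟧ (restrict π (ρ ∘ v)) σ
  ⟦relativize⟧ z v (pos R xs) σ π ρ inj =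
    cong (πpos π R) (≡.trans (≡.sym (map-∘ ρ (v ∘ σ) xs)) (map-∘ (ρ ∘ v) σ xs))
  ⟦relativize⟧ z v (neg R xs) σ π ρ inj =
    cong (πneg π R) (≡.trans (≡.sym (map-∘ ρ (v ∘ σ) xs)) (map-∘ (ρ ∘ v) σ xs))
  ⟦relativize⟧ z v (eq x y)  σ π ρ inj = boolVal-injective inj (σ x) (σ y)
  ⟦relativize⟧ z v (neq x y) σ π ρ inj = notBoolVal-injective inj (σ x) (σ y)
  ⟦relativize⟧ z v (φ ∨ᶠ ψ)  σ π ρ inj =
    cong₂ _+_ (⟦relativize⟧ z v φ σ π ρ inj) (⟦relativize⟧ z v ψ σ π ρ inj)
  ⟦relativize⟧ z v (φ ∧ᶠ ψ)  σ π ρ inj =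
    cong₂ _*_ (⟦relativize⟧ z v φ σ π ρ inj) (⟦relativize⟧ z v ψ σ π ρ inj)
  ⟦relativize⟧ {k = k} z v (ex φ) σ π ρ inj =
    ≡.trans (⟦⋁⟧ z {k} (λ i → relativize z v φ (extend i σ)) π ρ) (sumF-cong (λ i → ⟦relativize⟧ z v φ (extend i σ) π ρ inj))
  ⟦relativize⟧ {k = k} z v (all φ) σ π ρ inj =
    ≡.trans (⟦⋀⟧ z {k} (λ i → relativize z v φ (extend i σ)) π ρ) (prodF-cong (λ i → ⟦relativize⟧ z v φ (extend i σ) π ρ inj))

  ⟦relativizeˢ⟧ : ∀ {k K m} (z : Fin K) (v : Fin k → Fin K) (ψ : Sentence τ)
                  (π : Interp m) (ρ : Fin K → Fin m) → Injective _≡_ _≡_ (ρ ∘ v) →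
                  ⟦ relativizeˢ z v ψ ⟧ π ρ ≡ ⟦ ψ ⟧ˢ (restrict π (ρ ∘ v))
  ⟦relativizeˢ⟧ z v ψ π ρ inj =
    ≡.trans (⟦relativize⟧ z v ψ (λ ()) π ρ inj) (⟦⟧-cong ψ (restrict π (ρ ∘ v)) λ ())

  ⟦relativize⟧-QF : ∀ {a k K m} (z : Fin K) (v : Fin k → Fin K) {φ : Formula τ a} → QF φ →
                    ∀ σ (π : Interp m) (ρ : Fin K → Fin m) →
                    ⟦ relativize z v φ σ ⟧ π ρ ≡ ⟦ φ ⟧ π (ρ ∘ v ∘ σ)
  ⟦relativize⟧-QF z v (pos R xs) σ π ρ = cong (πpos π R) (≡.sym (map-∘ ρ (v ∘ σ) xs))
  ⟦relativize⟧-QF z v (neg R xs) σ π ρ = cong (πneg π R) (≡.sym (map-∘ ρ (v ∘ σ) xs))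
  ⟦relativize⟧-QF z v (eq x y)   σ π ρ = refl
  ⟦relativize⟧-QF z v (neq x y)  σ π ρ = refl
  ⟦relativize⟧-QF z v (q ∨ᶠ q')  σ π ρ =
    cong₂ _+_ (⟦relativize⟧-QF z v q σ π ρ) (⟦relativize⟧-QF z v q' σ π ρ)
  ⟦relativize⟧-QF z v (q ∧ᶠ q')  σ π ρ =
    cong₂ _*_ (⟦relativize⟧-QF z v q σ π ρ) (⟦relativize⟧-QF z v q' σ π ρ)

  data Indicates (v : Carrier) (Q : Set) : Set ℓ where
    off : v ≈ 0# → Indicates v Q
    on  : v ≈ 1# → Q → Indicates v Q

  Indicates-map : ∀ {v w Q Q'} → v ≡ w → (Q → Q') → Indicates w Q → Indicates v Q'
  Indicates-map refl f (off v≈0) = off v≈0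
  Indicates-map refl f (on v≈1 q) = on v≈1 (f q)

  prodF-Indicates : ∀ {k} (f : Fin k → Carrier) (Q : Fin k → Set) →
                    (∀ i → Indicates (f i) (Q i)) → Indicates (prodF f) (∀ i → Q i)
  prodF-Indicates {zero}  f Q h = on ≈-refl λ ()
  prodF-Indicates {suc k} f Q h with h zero | prodF-Indicates (f ∘ suc) (Q ∘ suc) (h ∘ suc)
  ... | off e   | _         = off (≈-trans (*-congʳ e) (zeroˡ _))
  ... | on _ _  | off e     = off (≈-trans (*-congˡ e) (zeroʳ _))
  ... | on e q  | on e' qs  = on (≈-trans (*-cong e e') (*-identityˡ 1#)) λ { zero → q ; (suc i) → qs i }

  ⟦apart⟧-Indicates : ∀ {k K m} (v : Fin k → Fin K) i j (π : Interp m) (ρ : Fin K → Fin m) →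
                      Indicates (⟦ apart v i j ⟧ π ρ) (ρ (v i) ≡ ρ (v j) → i ≡ j)
  ⟦apart⟧-Indicates v i j π ρ with i ≟ j
  ... | yes i≡j = on (reflexive (boolVal-refl (ρ (v i)))) (λ _ → i≡j)
  ... | no _ with ρ (v i) ≟ ρ (v j)
  ...   | yes _  = off ≈-refl
  ...   | no ne  = on ≈-refl (λ e → ⊥-elim (ne e))

  ⟦apart⟧-injective : ∀ {k K m} (v : Fin k → Fin K) i j (π : Interp m) (ρ : Fin K → Fin m) →
                      Injective _≡_ _≡_ (ρ ∘ v) → ⟦ apart v i j ⟧ π ρ ≈ 1#
  ⟦apart⟧-injective v i j π ρ inj with i ≟ j
  ... | yes _ = reflexive (boolVal-refl (ρ (v i)))
  ... | no i≢j with ρ (v i) ≟ ρ (v j)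
  ...   | yes e = ⊥-elim (i≢j (inj e))
  ...   | no _  = ≈-refl

  ⟦distinct⟧-Indicates : ∀ {k K m} (z : Fin K) (v : Fin k → Fin K) (π : Interp m) (ρ : Fin K → Fin m) →
                         Indicates (⟦ distinct z v ⟧ π ρ) (Injective _≡_ _≡_ (ρ ∘ v))
  ⟦distinct⟧-Indicates {k} z v π ρ =
    Indicates-map (⟦⋀⟧ z {k} (λ i → ⋀ z (apart v i)) π ρ) (λ h {i} {j} → h i j)
      (prodF-Indicates _ _ λ i →
        Indicates-map (⟦⋀⟧ z {k} (apart v i) π ρ) id
          (prodF-Indicates _ _ (λ j → ⟦apart⟧-Indicates v i j π ρ)))

  ⟦distinct⟧-injective : ∀ {k K m} (z : Fin K) (v : Fin k → Fin K) (π : Interp m) (ρ : Fin K → Fin m) →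
                         Injective _≡_ _≡_ (ρ ∘ v) → ⟦ distinct z v ⟧ π ρ ≈ 1#
  ⟦distinct⟧-injective {k} z v π ρ inj =
    ≈-trans (reflexive (⟦⋀⟧ z {k} (λ i → ⋀ z (apart v i)) π ρ)) (prodF-1# _ λ i →
      ≈-trans (reflexive (⟦⋀⟧ z {k} (apart v i) π ρ))
        (prodF-1# _ λ j → ⟦apart⟧-injective v i j π ρ inj))

  EquivGe-mono : ∀ {n n'} {φ ψ : Sentence τ} → n ≤ n' → EquivGe n φ ψ → EquivGe n' φ ψ
  EquivGe-mono n≤n' φ≈ψ π md n'≤ = φ≈ψ π md (≤-trans n≤n' n'≤)

-- Semantics over an additively idempotent semiring

module IdempotentEvaluation {c ℓ} (S : CommutativeSemiring c ℓ) (τ : Signature)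
                            (idem : Semantics.AdditivelyIdempotent S τ) where
  open CommutativeSemiring S
    hiding (zero) renaming (refl to ≈-refl; sym to ≈-sym; trans to ≈-trans)
  open Semantics S τ
  open Evaluation S τ

  +-semilattice : Semilattice c ℓ
  +-semilattice = record
    { isSemilattice = record { isBand = record { isSemigroup = +-isSemigroup ; idem = idem }
                             ; comm = +-comm } }

  -- x ⊑ y is y ≈ y + x, the dual of the natural meet order of (Carrier, +).
  +-joinSemilattice : JoinSemilattice c ℓ ℓ
  +-joinSemilattice = SemilatticeProperties.∧-orderTheoreticJoinSemilattice +-semilattice

  open JoinSemilattice +-joinSemilattice public
    using (poset; x≤x∨y; y≤x∨y; ∨-least)
    renaming (_≤_ to _⊑_; trans to ⊑-trans; antisym to ⊑-antisym; reflexive to ⊑-reflexive;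
              ≤-respʳ-≈ to ⊑-respʳ-≈)
  open PosetReasoning poset

  ≼⇒⊑ : ∀ {s t} → s ≼ t → s ⊑ t
  ≼⇒⊑ {s} (r , s+r≈t) = ⊑-respʳ-≈ s+r≈t (x≤x∨y s r)

  0#-⊑ : ∀ s → 0# ⊑ s
  0#-⊑ s = ≈-sym (+-identityʳ s)

  sumF-least : ∀ {k} (f : Fin k → Carrier) {y} → (∀ i → f i ⊑ y) → sumF f ⊑ y
  sumF-least {zero}  f h = 0#-⊑ _
  sumF-least {suc k} f h = ∨-least (h zero) (sumF-least (f ∘ suc) (h ∘ suc))

  ⊑-sumF : ∀ {k} (f : Fin k → Carrier) i → f i ⊑ sumF f
  ⊑-sumF f zero    = x≤x∨y _ _
  ⊑-sumF f (suc i) = ⊑-trans (⊑-sumF (f ∘ suc) i) (y≤x∨y _ _)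

  Indicates-*-⊑ : ∀ {v w y Q} → Indicates v Q → (Q → w ⊑ y) → v * w ⊑ y
  Indicates-*-⊑ {v} {w} {y} (off v≈0) _ = begin
    v * w  ≈⟨ *-congʳ v≈0 ⟩
    0# * w ≈⟨ zeroˡ w ⟩
    0#     ≤⟨ 0#-⊑ y ⟩
    y      ∎
  Indicates-*-⊑ {v} {w} {y} (on v≈1 q) w⊑y = begin
    v * w  ≈⟨ *-congʳ v≈1 ⟩
    1# * w ≈⟨ *-identityˡ w ⟩
    w      ≤⟨ w⊑y q ⟩
    y      ∎

  ⊑-1#-* : ∀ {v} w → v ≈ 1# → w ⊑ v * w
  ⊑-1#-* w v≈1 = ⊑-reflexive (≈-sym (≈-trans (*-congʳ v≈1) (*-identityˡ w)))

  module _ {m} (π : Interp m) where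

    ⟦⋁⟧-least : ∀ {K} (z : Fin K) {n} (f : Fin n → Formula τ K) ρ {y} →
                (∀ i → ⟦ f i ⟧ π ρ ⊑ y) → ⟦ ⋁ z f ⟧ π ρ ⊑ y
    ⟦⋁⟧-least z f ρ {y} h = ≡.subst (_⊑ y) (≡.sym (⟦⋁⟧ z f π ρ)) (sumF-least _ h)

    ⊑-⟦⋁⟧ : ∀ {K} (z : Fin K) {n} (f : Fin n → Formula τ K) ρ i → ⟦ f i ⟧ π ρ ⊑ ⟦ ⋁ z f ⟧ π ρ
    ⊑-⟦⋁⟧ z f ρ i = ≡.subst (⟦ f i ⟧ π ρ ⊑_) (≡.sym (⟦⋁⟧ z f π ρ)) (⊑-sumF _ i)

    ⟦∃*⟧-least : ∀ {n} k (φ : Formula τ (k ⊕ n)) σ {y} →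
                 (∀ ρ → ⟦ φ ⟧ π ρ ⊑ y) → ⟦ ∃* k φ ⟧ π σ ⊑ y
    ⟦∃*⟧-least zero    φ σ h = h σ
    ⟦∃*⟧-least (suc k) φ σ h = sumF-least _ (λ a → ⟦∃*⟧-least k φ (extend a σ) h)

    ⊑-⟦∃*⟧ : ∀ {n} k (φ : Formula τ (k ⊕ n)) ρ → ⟦ φ ⟧ π ρ ⊑ ⟦ ∃* k φ ⟧ π (ρ ∘ weaken k)
    ⊑-⟦∃*⟧ zero    φ ρ = ⊑-reflexive ≈-refl
    ⊑-⟦∃*⟧ (suc k) φ ρ = begin
      ⟦ φ ⟧ π ρ                                         ≤⟨ ⊑-⟦∃*⟧ k φ ρ ⟩
      ⟦ ∃* k φ ⟧ π (ρ ∘ weaken k)                       ≡⟨ ⟦⟧-cong (∃* k φ) π ρ∘weaken-extend ⟩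
      ⟦ ∃* k φ ⟧ π (extend x (ρ ∘ weaken (suc k)))      ≤⟨ ⊑-sumF _ x ⟩
      ⟦ ∃* (suc k) φ ⟧ π (ρ ∘ weaken (suc k))           ∎
      where
        x = ρ (weaken k zero)
        ρ∘weaken-extend : ∀ i → ρ (weaken k i) ≡ extend x (ρ ∘ weaken (suc k)) i
        ρ∘weaken-extend zero    = refl
        ρ∘weaken-extend (suc i) = refl

    ⊑-⟦∃*⟧ˢ : ∀ k (φ : Formula τ (k ⊕ 0)) ρ → ⟦ φ ⟧ π ρ ⊑ ⟦ ∃* k φ ⟧ˢ π
    ⊑-⟦∃*⟧ˢ k φ ρ = ≡.subst (⟦ φ ⟧ π ρ ⊑_) (⟦⟧-cong (∃* k φ) π λ ()) (⊑-⟦∃*⟧ k φ ρ)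

    ⟦Σ₁⟧ˢ-least : ∀ {φ : Sentence τ} (h : IsΣ₁ φ) {y} →
                  (∀ ρ → ⟦ matrix h ⟧ π ρ ⊑ y) → ⟦ φ ⟧ˢ π ⊑ y
    ⟦Σ₁⟧ˢ-least {φ} h {y} bound = ≡.subst (λ χ → ⟦ χ ⟧ˢ π ⊑ y) (≡.sym (∃*-matrix h))
      (⟦∃*⟧-least (prefixLength h) (matrix h) _ bound)

    ⊑-⟦Σ₁⟧ˢ : ∀ {φ : Sentence τ} (h : IsΣ₁ φ) ρ → ⟦ matrix h ⟧ π ρ ⊑ ⟦ φ ⟧ˢ π
    ⊑-⟦Σ₁⟧ˢ h ρ = ≡.subst (λ χ → ⟦ matrix h ⟧ π ρ ⊑ ⟦ χ ⟧ˢ π) (≡.sym (∃*-matrix h))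
      (⊑-⟦∃*⟧ˢ (prefixLength h) (matrix h) ρ)

  module _ {ψ : Sentence τ} (pres : PreservedUnderExtensions ψ)
           {m} (π : Interp (suc m)) (md : ModelDefining π) where

    restrict-⊑ : ∀ {k} {g : Fin (suc k) → Fin (suc m)} → Injective _≡_ _≡_ g →
                 ⟦ ψ ⟧ˢ (restrict π g) ⊑ ⟦ ψ ⟧ˢ π
    restrict-⊑ {g = g} inj =
      ≼⇒⊑ (pres (restrict π g) π g (restrict-ModelDefining π g md) md (restrict-⊆ π inj))

    ⊑-restrict : ∀ {k} {g : Fin (suc k) → Fin (suc m)} (h : Fin (suc m) → Fin (suc k)) →
                 (∀ x → g (h x) ≡ x) → ⟦ ψ ⟧ˢ π ⊑ ⟦ ψ ⟧ˢ (restrict π g)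
    ⊑-restrict {g = g} h gh≡id =
      ≼⇒⊑ (pres π (restrict π g) h md (restrict-ModelDefining π g md) (⊆-restrict π gh≡id))

    ⟦inSubstructure⟧-⊑ : ∀ {k K} (z : Fin K) (v : Fin (suc k) → Fin K) ρ →
                         ⟦ inSubstructure z v ψ ⟧ π ρ ⊑ ⟦ ψ ⟧ˢ π
    ⟦inSubstructure⟧-⊑ z v ρ = Indicates-*-⊑ (⟦distinct⟧-Indicates z v π ρ) λ inj → begin
      ⟦ relativizeˢ z v ψ ⟧ π ρ   ≡⟨ ⟦relativizeˢ⟧ z v ψ π ρ inj ⟩
      ⟦ ψ ⟧ˢ (restrict π (ρ ∘ v)) ≤⟨ restrict-⊑ inj ⟩
      ⟦ ψ ⟧ˢ π                    ∎

    ⊑-⟦inSubstructure⟧ : ∀ {k K} (z : Fin K) (v : Fin (suc k) → Fin K) ρ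
                         (h : Fin (suc m) → Fin (suc k)) →
                         (∀ x → ρ (v (h x)) ≡ x) → (∀ i → h (ρ (v i)) ≡ i) →
                         ⟦ ψ ⟧ˢ π ⊑ ⟦ inSubstructure z v ψ ⟧ π ρ
    ⊑-⟦inSubstructure⟧ z v ρ h gh≡id hg≡id = begin
      ⟦ ψ ⟧ˢ π                     ≤⟨ ⊑-restrict h gh≡id ⟩
      ⟦ ψ ⟧ˢ (restrict π (ρ ∘ v))  ≡⟨ ⟦relativizeˢ⟧ z v ψ π ρ inj ⟨
      ⟦ relativizeˢ z v ψ ⟧ π ρ    ≤⟨ ⊑-1#-* _ (⟦distinct⟧-injective z v π ρ inj) ⟩
      ⟦ inSubstructure z v ψ ⟧ π ρ ∎
      where
        inj : Injective _≡_ _≡_ (ρ ∘ v)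
        inj {i} {j} e = ≡.trans (≡.sym (hg≡id i)) (≡.trans (cong h e) (hg≡id j))

module Σ₁CompletionCorrect {c ℓ} (S : CommutativeSemiring c ℓ) {τ : Signature}
                           (idem : Semantics.AdditivelyIdempotent S τ)
                           {ψ : Sentence τ} (pres : Semantics.PreservedUnderExtensions S τ ψ)
                           {φ : Sentence τ} (φ-Σ₁ : IsΣ₁ φ) (n : ℕ)
                           (φ≈ψ : Semantics.EquivGe S τ (suc n) φ ψ) where
  open CommutativeSemiring S using (_≈_)
  open Semantics S τ
  open Evaluation S τ
  open IdempotentEvaluation S τ idem
  open PosetReasoning poset
  open Σ₁Completion ψ φ-Σ₁ n

  module _ {k} (π : Interp (suc k)) (md : ModelDefining π) where

    large-⊑ψ : ∀ ρ → ⟦ large ⟧ π ρ ⊑ ⟦ ψ ⟧ˢ π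
    large-⊑ψ ρ = Indicates-*-⊑ (⟦distinct⟧-Indicates x₀ (fresh N) π ρ) λ inj → begin
      ⟦ relativize x₀ (weaken N) (matrix φ-Σ₁) id ⟧ π ρ
        ≡⟨ ⟦relativize⟧-QF x₀ (weaken N) (matrix-QF φ-Σ₁) id π ρ ⟩
      ⟦ matrix φ-Σ₁ ⟧ π (ρ ∘ weaken N) ≤⟨ ⊑-⟦Σ₁⟧ˢ π φ-Σ₁ (ρ ∘ weaken N) ⟩
      ⟦ φ ⟧ˢ π                         ≈⟨ φ≈ψ π md (injective⇒≤ inj) ⟩
      ⟦ ψ ⟧ˢ π                         ∎

    body-⊑ψ : ∀ ρ → ⟦ body ⟧ π ρ ⊑ ⟦ ψ ⟧ˢ π
    body-⊑ψ ρ = ∨-least (large-⊑ψ ρ)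
      (⟦⋁⟧-least π x₀ small ρ (λ j → ⟦inSubstructure⟧-⊑ {ψ} pres π md x₀ (firstVars j) ρ))

    body-⊑completion : ∀ ρ → ⟦ body ⟧ π ρ ⊑ ⟦ completion ⟧ˢ π
    body-⊑completion ρ = ⊑-trans (⊑-⟦∃*⟧ π N body ρ)
      (⊑-⟦∃*⟧ˢ π (prefixLength φ-Σ₁) (∃* N body) (ρ ∘ weaken N))

    completion-⊑ψ : ⟦ completion ⟧ˢ π ⊑ ⟦ ψ ⟧ˢ π
    completion-⊑ψ = ⟦∃*⟧-least π (prefixLength φ-Σ₁) (∃* N body) _
      (λ ρ → ⟦∃*⟧-least π N body ρ body-⊑ψ)

    ψ-⊑completion-large : N ≤ suc k → ⟦ ψ ⟧ˢ π ⊑ ⟦ completion ⟧ˢ π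
    ψ-⊑completion-large N≤ = begin
      ⟦ ψ ⟧ˢ π          ≈⟨ φ≈ψ π md N≤ ⟨
      ⟦ φ ⟧ˢ π          ≤⟨ ⟦Σ₁⟧ˢ-least π φ-Σ₁ matrix-⊑completion ⟩
      ⟦ completion ⟧ˢ π ∎
      where
        matrix-⊑completion : ∀ ȳ → ⟦ matrix φ-Σ₁ ⟧ π ȳ ⊑ ⟦ completion ⟧ˢ π
        matrix-⊑completion ȳ = begin
          ⟦ matrix φ-Σ₁ ⟧ π ȳ
            ≡⟨ ⟦⟧-cong (matrix φ-Σ₁) π (λ i → ≡.sym (extendMany-weaken N u ȳ i)) ⟩
          ⟦ matrix φ-Σ₁ ⟧ π (ρ ∘ weaken N)
            ≡⟨ ⟦relativize⟧-QF x₀ (weaken N) (matrix-QF φ-Σ₁) id π ρ ⟨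
          ⟦ relativize x₀ (weaken N) (matrix φ-Σ₁) id ⟧ π ρ
            ≤⟨ ⊑-1#-* _ (⟦distinct⟧-injective x₀ (fresh N) π ρ ρ∘fresh-injective) ⟩
          ⟦ large ⟧ π ρ      ≤⟨ x≤x∨y _ _ ⟩
          ⟦ body ⟧ π ρ       ≤⟨ body-⊑completion ρ ⟩
          ⟦ completion ⟧ˢ π ∎
          where
            u : Fin N → Fin (suc k)
            u i = inject≤ i N≤
            ρ = extendMany N u ȳ
            ρ∘fresh-injective : Injective _≡_ _≡_ (ρ ∘ fresh N)
            ρ∘fresh-injective {i} {j} e = inject≤-injective N≤ N≤ i j
              (≡.trans (≡.sym (extendMany-fresh N u ȳ i)) (≡.trans e (extendMany-fresh N u ȳ j)))

    ψ-⊑completion-small : k < n → ⟦ ψ ⟧ˢ π ⊑ ⟦ completion ⟧ˢ π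
    ψ-⊑completion-small k<n = begin
      ⟦ ψ ⟧ˢ π           ≤⟨ ⊑-⟦inSubstructure⟧ {ψ} pres π md x₀ (firstVars j) ρ unsize
                                ρ∘firstVars∘unsize unsize∘ρ∘firstVars ⟩
      ⟦ small j ⟧ π ρ    ≤⟨ ⊑-⟦⋁⟧ π x₀ small ρ j ⟩
      ⟦ ⋁ x₀ small ⟧ π ρ ≤⟨ y≤x∨y _ _ ⟩
      ⟦ body ⟧ π ρ       ≤⟨ body-⊑completion ρ ⟩
      ⟦ completion ⟧ˢ π  ∎
      where
        j = fromℕ< k<n
        size : suc (toℕ j) ≡ suc k
        size = cong suc (toℕ-fromℕ< k<n)
        unsize : Fin (suc k) → Fin (suc (toℕ j))
        unsize = cast (≡.sym size)
        ρ = extendMany N (cast size ∘ clamp) (λ _ → zero)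

        ρ∘firstVars : ∀ i → ρ (firstVars j i) ≡ cast size i
        ρ∘firstVars i = ≡.trans (extendMany-fresh N (cast size ∘ clamp) _ _)
                                (cong (cast size) (clamp-inject≤ i (suc-toℕ≤N j)))

        ρ∘firstVars∘unsize : ∀ x → ρ (firstVars j (unsize x)) ≡ x
        ρ∘firstVars∘unsize x = ≡.trans (ρ∘firstVars (unsize x)) (cast-involutive size (≡.sym size) x)

        unsize∘ρ∘firstVars : ∀ i → unsize (ρ (firstVars j i)) ≡ i
        unsize∘ρ∘firstVars i = ≡.trans (cong unsize (ρ∘firstVars i)) (cast-involutive (≡.sym size) size i)

    completion-correct : ⟦ completion ⟧ˢ π ≈ ⟦ ψ ⟧ˢ π
    completion-correct with N ≤? suc k
    ... | yes N≤ = ⊑-antisym completion-⊑ψ (ψ-⊑completion-large N≤)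
    ... | no  N≰ = ⊑-antisym completion-⊑ψ (ψ-⊑completion-small (≤-pred (≰⇒> N≰)))

mainTheorem18 : ∀ {c ℓ} (S : CommutativeSemiring c ℓ) (τ : Signature) →
    Semantics.AdditivelyIdempotent S τ →
    (ψ : Sentence τ) →
    Semantics.PreservedUnderExtensions S τ ψ →
    (Σ (Sentence τ) λ φ → IsΣ₁ φ × Σ ℕ λ n → Semantics.EquivGe S τ n φ ψ) →
    Σ (Sentence τ) λ φ* → IsΣ₁ φ* × Semantics.EquivFin S τ φ* ψ
mainTheorem18 S τ idem ψ pres (φ , φ-Σ₁ , n , φ≈ψ) =
  completion , completion-Σ₁ , completion-correct
  where
    open Σ₁Completion ψ φ-Σ₁ n using (completion; completion-Σ₁)
    open Σ₁CompletionCorrect S idem {ψ} pres φ-Σ₁ n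
      (Evaluation.EquivGe-mono S τ {φ = φ} {ψ} (n≤1+n n) φ≈ψ) using (completion-correct)
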